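{- Let $S$ be a numerical semigroup with minimal generators $a_1<a_2<\cdots<a_\nu$, multiplicity $\mu=a_1$ and conductor $c$, and suppose $a_2>\frac{c+\mu}{3}$. Let $P=\{a_1,\ldots,a_\nu\}$, $P_1=\{a\in P\setminus\{\mu\}\mid \frac{c+\mu}{3}<a<\frac{c+\mu}{2}\}$, $P_2=\{a\in P\setminus\{\mu\}\mid \frac{c+\mu}{2}\le a<\frac{2}{3}(c+\mu)\}$, $q_1=|P_1|$, $q_2=|P_2|$, and let $\sigma$ be the maximal cardinality of an independent set of Apéry pairs. Then $$|L(S)|\ge\left\lfloor\frac{c}{\mu}\right\rfloor(1+\sigma)+\left(\left\lfloor\frac12\frac{c}{\mu}-\frac12\right\rfloor+1\right)(q_1-\sigma)+\left(\left\lfloor\frac13\frac{c}{\mu}-\frac23\right\rfloor+1\right)(q_2-\sigma).$$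
   Context: A numerical semigroup is a subset $S\subseteq\mathbb{N}$ containing $0$, closed under addition, with $\mathbb{N}\setminus S$ finite. Its conductor $c=c(S)$ is the least integer $x$ with $x+\mathbb{N}\subseteq S$. $S$ has a unique minimal set of generators; its cardinality is the embedding dimension $\nu(S)$ and its least element is the multiplicity $\mu(S)$. $L(S)=\{x\in S\mid 0\le x<c(S)\}$. The Apéry set of $S$ is $\mathrm{Ap}(S)=\{s\in S\mid s-\mu\notin S\}$. A pair $(a,b)\in P_1\times P_2$ is an Apéry pair if $a+b\in\mathrm{Ap}(S)$. A set $\{(a_i,b_i)\}_{i=1}^n$ of Apéry pairs is independent if $a_i\ne a_j$ and $b_i\ne b_j$ for all $i\ne j$. -}

module Defs where

open import Data.Nat as ℕ using (ℕ; zero; suc; _+_; _*_; _≤_; _<_)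
open import Data.Integer as ℤ using (ℤ; +_)
open import Data.Rational as ℚ using (ℚ; floor; ½)
open import Data.Product using (Σ; ∃; _×_; _,_)
open import Data.List using (List; length)
open import Data.List.Membership.Propositional using (_∈_)
open import Data.List.Relation.Unary.AllPairs using (AllPairs)
open import Relation.Binary.PropositionalEquality using (_≡_; _≢_)
open import Relation.Nullary using (¬_)
open import Function.Bundles using (_⇔_)

record NumericalSemigroup : Set₁ where
  field
    Mem      : ℕ → Set
    zero∈    : Mem 0
    closed   : ∀ {x y} → Mem x → Mem y → Mem (x + y)
    cofinite : ∃ λ N → ∀ x → N ≤ x → Mem x
open NumericalSemigroup public

HasSize : ∀ {A : Set} → (A → Set) → ℕ → Set
HasSize {A} P n =
  Σ (List A) λ l → AllPairs _≢_ l × (∀ x → (x ∈ l) ⇔ P x) × length l ≡ n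

module _ (S : NumericalSemigroup) where

  IsConductor : ℕ → Set
  IsConductor c = (∀ x → c ≤ x → Mem S x)
                × (∀ d → (∀ x → d ≤ x → Mem S x) → c ≤ d)

  IsMinGen : ℕ → Set
  IsMinGen a = Mem S a × a ≢ 0
             × ¬ (Σ ℕ λ x → Σ ℕ λ y → Mem S x × Mem S y × x ≢ 0 × y ≢ 0 × x + y ≡ a)

  IsMultiplicity : ℕ → Set
  IsMultiplicity μ = IsMinGen μ × (∀ a → IsMinGen a → μ ≤ a)

  InL : ℕ → ℕ → Set
  InL c x = Mem S x × x < c

  InAp : ℕ → ℕ → Set
  InAp μ s = Mem S s × ¬ (Σ ℕ λ t → Mem S t × t + μ ≡ s)

  InP₁ : ℕ → ℕ → ℕ → Set
  InP₁ c μ a = IsMinGen a × a ≢ μ × c + μ < 3 * a × 2 * a < c + μ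

  InP₂ : ℕ → ℕ → ℕ → Set
  InP₂ c μ a = IsMinGen a × a ≢ μ × c + μ ≤ 2 * a × 3 * a < 2 * (c + μ)

  IsAperyPair : ℕ → ℕ → ℕ × ℕ → Set
  IsAperyPair c μ (a , b) = InP₁ c μ a × InP₂ c μ b × InAp μ (a + b)

  IsIndependent : ℕ → ℕ → List (ℕ × ℕ) → Set
  IsIndependent c μ l =
    (∀ p → p ∈ l → IsAperyPair c μ p)
    × AllPairs (λ { (a , b) (a′ , b′) → a ≢ a′ × b ≢ b′ }) l

  IsMaxIndep : ℕ → ℕ → ℕ → Set
  IsMaxIndep c μ σ =
    (Σ (List (ℕ × ℕ)) λ l → IsIndependent c μ l × length l ≡ σ)
    × (∀ l → IsIndependent c μ l → length l ≤ σ)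

-- right-hand side of the bound:
-- ⌊c/μ⌋(1+σ) + (⌊½·c/μ − ½⌋ + 1)(q₁ − σ) + (⌊⅓·c/μ − ⅔⌋ + 1)(q₂ − σ)
-- (computed in ℤ; μ = 0 never occurs since μ is a minimal generator)
bound : (c μ σ q₁ q₂ : ℕ) → ℤ
bound c zero σ q₁ q₂ = + 0
bound c (suc m) σ q₁ q₂ =
    floor cμ ℤ.* (+ 1 ℤ.+ + σ)
  ℤ.+ (floor (½ ℚ.* cμ ℚ.- ½) ℤ.+ + 1) ℤ.* (+ q₁ ℤ.- + σ)
  ℤ.+ (floor ((+ 1 ℚ./ 3) ℚ.* cμ ℚ.- (+ 2 ℚ./ 3)) ℤ.+ + 1) ℤ.* (+ q₂ ℤ.- + σ)
  where
  cμ : ℚ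
  cμ = + c ℚ./ suc m

module Submission where

-- For h ∈ S let
-- depth h be the number of terms of h, h + μ, h + 2μ, … below c.  These terms
-- (the chain of h) lie in L(S), and chains of distinct Apéry elements are
-- disjoint, so the depths of distinct Apéry elements add up to at most |L(S)|.
-- Apply this to 0 and to the generators in P₁ ∪ P₂, which are Apéry elements:
-- depth 0 ≥ ⌊c/μ⌋, depth ≥ ⌊(c+μ)/2μ⌋ on P₁ and ≥ ⌊(c+μ)/3μ⌋ on P₂, and
-- depth a + depth b ≥ ⌊c/μ⌋ for an Apéry pair (a, b) since a + b < c + μ.

open import Defs
open import Data.Nat.Base using (ℕ; NonZero)
open import Data.List.Base using (List)
open import Data.Product.Base using (_×_)

module Counting {A : Set} where

  open import Data.Nat
  open import Data.Nat.Properties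
  open import Data.Nat.ListAction using (sum)
  open import Data.Nat.ListAction.Properties using (sum-↭)
  open import Data.List using ([]; _∷_; _++_; map; length)
  open import Data.List.Membership.Propositional using (_∈_)
  open import Data.List.Membership.Propositional.Properties using (∈-∃++)
  open import Data.List.Relation.Unary.Any using (here; there)
  import Data.List.Relation.Unary.All as All
  open import Data.List.Relation.Unary.AllPairs using (AllPairs; _∷_)
  open import Data.List.Relation.Binary.Subset.Propositional using (_⊆_)
  open import Data.List.Relation.Binary.Permutation.Propositional using (_↭_; ↭-sym)
  open import Data.List.Relation.Binary.Permutation.Propositional.Properties
    using (shift; ∈-resp-↭; ↭-length) renaming (map⁺ to ↭-map⁺)
  open import Data.Product using (∃; _,_; proj₁; proj₂)
  open import Relation.Binary.PropositionalEquality
  open import Relation.Nullary using (contradiction)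
  open import Algebra.Properties.CommutativeSemigroup +-commutativeSemigroup using (interchange)

  sum-≥ : (f : A → ℕ) (t : ℕ) (xs : List A) → (∀ x → x ∈ xs → t ≤ f x)
        → length xs * t ≤ sum (map f xs)
  sum-≥ f t []       _ = z≤n
  sum-≥ f t (x ∷ xs) h = +-mono-≤ (h x (here refl)) (sum-≥ f t xs (λ y y∈ → h y (there y∈)))

  extract : ∀ {x} {ys : List A} → x ∈ ys → ∃ λ zs → ys ↭ x ∷ zs
  extract x∈ with us , vs , refl ← ∈-∃++ x∈ = us ++ vs , shift _ us vs

  ∈-remove : ∀ {x y} {zs : List A} → x ≢ y → y ∈ x ∷ zs → y ∈ zs
  ∈-remove x≢y (here y≡x) = contradiction (sym y≡x) x≢y
  ∈-remove x≢y (there y∈) = y∈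

  sum-sublist : (f : A → ℕ) (t : ℕ) (xs ys : List A) → AllPairs _≢_ xs → xs ⊆ ys
              → (∀ y → y ∈ ys → t ≤ f y)
              → sum (map f xs) + (length ys ∸ length xs) * t ≤ sum (map f ys)
  sum-sublist f t []       ys _            _     h = sum-≥ f t ys h
  sum-sublist f t (x ∷ xs) ys (x∉xs ∷ uxs) xs⊆ys h
    with zs , ys↭ ← extract (xs⊆ys (here refl)) = begin
      f x + sum (map f xs) + (length ys ∸ suc (length xs)) * t
        ≡⟨ cong (λ n → f x + sum (map f xs) + (n ∸ suc (length xs)) * t) (↭-length ys↭) ⟩
      f x + sum (map f xs) + (length zs ∸ length xs) * t
        ≡⟨ +-assoc (f x) _ _ ⟩
      f x + (sum (map f xs) + (length zs ∸ length xs) * t)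
        ≤⟨ +-monoʳ-≤ (f x) (sum-sublist f t xs zs uxs xs⊆zs (λ z z∈ → h z (zs⊆ys z∈))) ⟩
      f x + sum (map f zs)
        ≡⟨ sum-↭ (↭-map⁺ f (↭-sym ys↭)) ⟩
      sum (map f ys) ∎
    where
    open ≤-Reasoning
    zs⊆ys : zs ⊆ ys
    zs⊆ys z∈ = ∈-resp-↭ (↭-sym ys↭) (there z∈)
    xs⊆zs : xs ⊆ zs
    xs⊆zs y∈ = ∈-remove (All.lookup x∉xs y∈) (∈-resp-↭ ys↭ (xs⊆ys (there y∈)))

  length-sublist : (xs ys : List A) → AllPairs _≢_ xs → xs ⊆ ys → length xs ≤ length ys
  length-sublist xs ys uxs xs⊆ys = subst₂ _≤_ (sum-ones xs) (sum-ones ys)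
    (m+n≤o⇒m≤o _ (sum-sublist (λ _ → 1) 0 xs ys uxs xs⊆ys (λ _ _ → z≤n)))
    where
    sum-ones : (zs : List A) → sum (map (λ _ → 1) zs) ≡ length zs
    sum-ones []       = refl
    sum-ones (_ ∷ zs) = cong suc (sum-ones zs)

  sum-pairs : (f : A → ℕ) (K : ℕ) (ps : List (A × A))
            → (∀ p → p ∈ ps → K ≤ f (proj₁ p) + f (proj₂ p))
            → length ps * K ≤ sum (map f (map proj₁ ps)) + sum (map f (map proj₂ ps))
  sum-pairs f K []             _ = z≤n
  sum-pairs f K ((a , b) ∷ ps) h = begin
      K + length ps * K
        ≤⟨ +-mono-≤ (h (a , b) (here refl)) (sum-pairs f K ps (λ p p∈ → h p (there p∈))) ⟩
      (f a + f b) + (sum (map f (map proj₁ ps)) + sum (map f (map proj₂ ps)))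
        ≡⟨ interchange (f a) (f b) _ _ ⟩
      (f a + sum (map f (map proj₁ ps))) + (f b + sum (map f (map proj₂ ps))) ∎
    where open ≤-Reasoning

module Division where

  open import Data.Nat
  open import Data.Nat.Properties
  open import Data.Nat.DivMod using (m*n/n≡m; /-monoˡ-≤; m≡m%n+[m/n]*n; m%n<n)
  open import Relation.Binary.PropositionalEquality

  m<[1+m/d]*d : ∀ m d .{{_ : NonZero d}} → m < suc (m / d) * d
  m<[1+m/d]*d m d = subst (_< d + (m / d) * d) (sym (m≡m%n+[m/n]*n m d))
                          (+-monoˡ-< ((m / d) * d) (m%n<n m d))

  k*d≤m⇒k≤m/d : ∀ k m d .{{_ : NonZero d}} → k * d ≤ m → k ≤ m / d
  k*d≤m⇒k≤m/d k m d k*d≤m = subst (_≤ m / d) (m*n/n≡m k d) (/-monoˡ-≤ d k*d≤m)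

module Depth (c μ : ℕ) {{_ : NonZero μ}} where

  open import Data.Nat
  open import Data.Nat.Properties
  open import Data.Nat.DivMod using (m/n*n≤m)
  open import Data.Nat.Tactic.RingSolver using (solve-∀)
  open import Relation.Binary.PropositionalEquality
  open Division

  -- The number of terms of h, h + μ, h + 2μ, … that lie below c.
  depth : ℕ → ℕ
  depth h = (c + μ ∸ suc h) / μ

  ≤-depth : ∀ h k → k * μ + h < c + μ → k ≤ depth h
  ≤-depth h k lt = k*d≤m⇒k≤m/d k _ μ
    (m+n≤o⇒m≤o∸n (k * μ) (subst (_≤ c + μ) (sym (+-suc (k * μ) h)) lt))

  depth-< : ∀ h k → k < depth h → h + k * μ < c
  depth-< h k k<d = +-cancelʳ-≤ μ (suc (h + k * μ)) c (begin
      suc (h + k * μ) + μ ≡⟨ rearrange h k μ ⟩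
      suc k * μ + suc h   ≤⟨ m≤o∸n⇒m+n≤o (suc k * μ) h<c+μ kμ≤ ⟩
      c + μ               ∎)
    where
    open ≤-Reasoning
    rearrange : ∀ h k μ → suc (h + k * μ) + μ ≡ suc k * μ + suc h
    rearrange = solve-∀
    kμ≤ : suc k * μ ≤ c + μ ∸ suc h
    kμ≤ = ≤-trans (*-monoˡ-≤ μ k<d) (m/n*n≤m (c + μ ∸ suc h) μ)
    h<c+μ : suc h ≤ c + μ
    h<c+μ = <⇒≤ (m∸n≢0⇒n<m λ Y≡0 →
      <⇒≱ (>-nonZero⁻¹ μ) (subst (μ ≤_) Y≡0 (≤-trans (m≤m+n μ (k * μ)) kμ≤)))

  depth-reach : ∀ h → h < c + μ → c ≤ h + depth h * μ
  depth-reach h h<c+μ = +-cancelʳ-≤ μ c (h + depth h * μ) (begin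
      c + μ                    ≡⟨ m∸n+n≡m h<c+μ ⟨
      Y + suc h                ≡⟨ +-suc Y h ⟩
      suc Y + h                ≤⟨ +-monoˡ-≤ h (m<[1+m/d]*d Y μ) ⟩
      suc (depth h) * μ + h    ≡⟨ rearrange (depth h) h μ ⟩
      h + depth h * μ + μ      ∎)
    where
    open ≤-Reasoning
    Y : ℕ
    Y = c + μ ∸ suc h
    rearrange : ∀ d h μ → suc d * μ + h ≡ h + d * μ + μ
    rearrange = solve-∀

  ⌊c/μ⌋≤depth0 : c / μ ≤ depth 0
  ⌊c/μ⌋≤depth0 = ≤-depth 0 (c / μ) (subst (_< c + μ) (sym (+-identityʳ _))
                   (≤-<-trans (m/n*n≤m c μ) (m<m+n c (>-nonZero⁻¹ μ))))

  ⌊c/μ⌋≤depth-pair : ∀ a b → a + b < c + μ → c / μ ≤ depth a + depth b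
  ⌊c/μ⌋≤depth-pair a b a+b<c+μ = s≤s⁻¹ (*-cancelʳ-< μ (c / μ) (suc (depth a + depth b))
      (≤-<-trans (m/n*n≤m c μ) c<))
    where
    open ≤-Reasoning
    reach-sum : c + c ≤ (a + b) + (depth a + depth b) * μ
    reach-sum = begin
      c + c                                  ≤⟨ +-mono-≤ (depth-reach a a<c+μ) (depth-reach b b<c+μ) ⟩
      (a + depth a * μ) + (b + depth b * μ)  ≡⟨ rearrange a b (depth a) (depth b) μ ⟩
      (a + b) + (depth a + depth b) * μ      ∎
      where
      a<c+μ : a < c + μ
      a<c+μ = m+n≤o⇒m≤o (suc a) a+b<c+μ
      b<c+μ : b < c + μ
      b<c+μ = m+n≤o⇒n≤o a (subst (_≤ c + μ) (sym (+-suc a b)) a+b<c+μ)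
      rearrange : ∀ a b d e μ → (a + d * μ) + (b + e * μ) ≡ (a + b) + (d + e) * μ
      rearrange = solve-∀
    c< : c < suc (depth a + depth b) * μ
    c< = +-cancelˡ-< c c _ (begin-strict
      c + c                                 ≤⟨ reach-sum ⟩
      (a + b) + (depth a + depth b) * μ     <⟨ +-monoˡ-< _ a+b<c+μ ⟩
      (c + μ) + (depth a + depth b) * μ     ≡⟨ +-assoc c μ _ ⟩
      c + suc (depth a + depth b) * μ       ∎)

  quotient : ℕ → ℕ
  quotient j = ((c + μ) / (suc j * μ)) {{m*n≢0 (suc j) μ}}

  -- Every h with (j + 1)h < j(c + μ) has depth at least quotient j; for j = 1, 2
  -- this covers the windows P₁ and P₂.
  quotient≤depth : ∀ j h → suc j * h < j * (c + μ) → quotient j ≤ depth h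
  quotient≤depth j h lt = ≤-depth h (quotient j) (*-cancelˡ-< (suc j) _ _ (begin-strict
      suc j * (quotient j * μ + h)          ≡⟨ rearrange j (quotient j) μ h ⟩
      quotient j * (suc j * μ) + suc j * h
        <⟨ +-mono-≤-< (m/n*n≤m (c + μ) (suc j * μ) {{m*n≢0 (suc j) μ}}) lt ⟩
      (c + μ) + j * (c + μ)                 ≡⟨⟩
      suc j * (c + μ)                       ∎))
    where
    open ≤-Reasoning
    rearrange : ∀ j q μ h → suc j * (q * μ + h) ≡ q * (suc j * μ) + suc j * h
    rearrange = solve-∀

  c<quotient : ∀ j → c < (suc j * quotient j + j) * μ
  c<quotient j = +-cancelʳ-< μ c _ (begin-strict
      c + μ                                   <⟨ m<[1+m/d]*d (c + μ) (suc j * μ) {{m*n≢0 (suc j) μ}} ⟩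
      suc (quotient j) * (suc j * μ)          ≡⟨ rearrange j (quotient j) μ ⟩
      (suc j * quotient j + j) * μ + μ        ∎)
    where
    open ≤-Reasoning
    rearrange : ∀ j q μ → suc q * (suc j * μ) ≡ (suc j * q + j) * μ + μ
    rearrange = solve-∀

module AperyChains (S : NumericalSemigroup) (μ : ℕ) {{_ : NonZero μ}} (μ∈S : Mem S μ) (c : ℕ) where

  open import Data.Nat
  open import Data.Nat.Properties
  open import Data.Nat.ListAction using (sum)
  open import Data.List using ([]; _∷_; map; length; upTo; concatMap)
  open import Data.List.Properties using (length-++; length-map; length-upTo)
  open import Data.List.Membership.Propositional using (_∈_)
  open import Data.List.Membership.Propositional.Properties using (∈-map⁻; ∈-upTo⁻; ∈-concat⁻′)
  open import Data.List.Relation.Unary.All as All using (All; _∷_)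
  open import Data.List.Relation.Unary.AllPairs using (AllPairs; []; _∷_)
  import Data.List.Relation.Unary.AllPairs.Properties as AllPairs
  import Data.List.Relation.Unary.Unique.Propositional.Properties as Unique
  open import Data.Product using (∃; _,_; proj₁)
  open import Relation.Binary.PropositionalEquality
  open import Relation.Nullary using (yes; no; contradiction)
  open Counting using (length-sublist)
  open Depth c μ

  chain : ℕ → List ℕ
  chain h = map (λ k → h + k * μ) (upTo (depth h))

  private
    step : ∀ h k → h + suc k * μ ≡ h + k * μ + μ
    step h k = trans (cong (h +_) (+-comm μ (k * μ))) (sym (+-assoc h (k * μ) μ))

  +multiple∈S : ∀ h k → Mem S h → Mem S (h + k * μ)
  +multiple∈S h zero    h∈S = subst (Mem S) (sym (+-identityʳ h)) h∈S
  +multiple∈S h (suc k) h∈S = subst (Mem S) (sym (step h k)) (closed S (+multiple∈S h k h∈S) μ∈S)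

  apéry-not-above : ∀ {w s} → InAp S μ w → Mem S s → ∀ k → w ≢ s + suc k * μ
  apéry-not-above (_ , w-μ∉S) s∈S k eq =
    w-μ∉S (_ , +multiple∈S _ k s∈S , trans (sym (step _ k)) (sym eq))

  apéry-progression-injective : ∀ {h h′} → InAp S μ h → InAp S μ h′
                              → ∀ k j → h + k * μ ≡ h′ + j * μ → h ≡ h′
  apéry-progression-injective {h} {h′} _ _ zero zero eq =
    trans (sym (+-identityʳ h)) (trans eq (+-identityʳ h′))
  apéry-progression-injective {h} ap ap′ zero (suc j) eq =
    contradiction (trans (sym (+-identityʳ h)) eq) (apéry-not-above ap (proj₁ ap′) j)
  apéry-progression-injective {h} {h′} ap ap′ (suc k) zero eq =
    contradiction (trans (sym (+-identityʳ h′)) (sym eq)) (apéry-not-above ap′ (proj₁ ap) k)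
  apéry-progression-injective {h} {h′} ap ap′ (suc k) (suc j) eq =
    apéry-progression-injective ap ap′ k j
      (+-cancelʳ-≡ μ _ _ (trans (sym (step h k)) (trans eq (step h′ j))))

  0-apéry : InAp S μ 0
  0-apéry = zero∈ S , λ (t , _ , t+μ≡0) → ≢-nonZero⁻¹ μ (m+n≡0⇒n≡0 t t+μ≡0)

  -- A minimal generator a ≠ μ is an Apéry element: a = t + μ with t ∈ S would
  -- decompose it.
  minGen-apéry : ∀ {a} → IsMinGen S a → a ≢ μ → InAp S μ a
  minGen-apéry (a∈S , _ , irreducible) a≢μ = a∈S , λ (t , t∈S , t+μ≡a) →
    irreducible (t , μ , t∈S , μ∈S , (λ t≡0 → a≢μ (trans (sym t+μ≡a) (cong (_+ μ) t≡0)))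
                , ≢-nonZero⁻¹ μ , t+μ≡a)

  apéry-< : (∀ x → c ≤ x → Mem S x) → ∀ {s} → InAp S μ s → s < c + μ
  apéry-< c+ℕ⊆S {s} (_ , s-μ∉S) with c + μ ≤? s
  ... | yes c+μ≤s = contradiction (s ∸ μ , s∸μ∈S , s∸μ+μ≡s) s-μ∉S
    where
    s∸μ∈S : Mem S (s ∸ μ)
    s∸μ∈S = c+ℕ⊆S _ (m+n≤o⇒m≤o∸n c c+μ≤s)
    s∸μ+μ≡s : s ∸ μ + μ ≡ s
    s∸μ+μ≡s = m∸n+n≡m (m+n≤o⇒n≤o c c+μ≤s)
  ... | no  c+μ≰s = ≰⇒> c+μ≰s

  ∈-chain⁻ : ∀ {h x} → x ∈ chain h → ∃ λ k → k < depth h × x ≡ h + k * μ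
  ∈-chain⁻ {h} x∈ with k , k∈ , refl ← ∈-map⁻ (λ k → h + k * μ) x∈ =
    k , ∈-upTo⁻ k∈ , refl

  chain⊆L : ∀ {h x} → Mem S h → x ∈ chain h → InL S c x
  chain⊆L {h} h∈S x∈ with k , k<d , refl ← ∈-chain⁻ x∈ = +multiple∈S h k h∈S , depth-< h k k<d

  chain-unique : ∀ h → AllPairs _≢_ (chain h)
  chain-unique h =
    Unique.map⁺ (λ eq → *-cancelʳ-≡ _ _ μ (+-cancelˡ-≡ h _ _ eq)) (Unique.upTo⁺ (depth h))

  chains-disjoint : ∀ {h h′ x y} → InAp S μ h → InAp S μ h′ → h ≢ h′
                  → x ∈ chain h → y ∈ chain h′ → x ≢ y
  chains-disjoint ap ap′ h≢h′ x∈ y∈ refl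
    with k , _ , refl ← ∈-chain⁻ x∈ | j , _ , eq ← ∈-chain⁻ y∈ =
    h≢h′ (apéry-progression-injective ap ap′ k j eq)

  ∈-chains⁻ : ∀ {x} hs → x ∈ concatMap chain hs → ∃ λ h → h ∈ hs × x ∈ chain h
  ∈-chains⁻ hs x∈ with xs , x∈xs , xs∈ ← ∈-concat⁻′ (map chain hs) x∈
                   with h , h∈ , refl ← ∈-map⁻ chain xs∈ = h , h∈ , x∈xs

  chains-unique : ∀ hs → AllPairs _≢_ hs → All (InAp S μ) hs → AllPairs _≢_ (concatMap chain hs)
  chains-unique []       _             _           = []
  chains-unique (h ∷ hs) (h∉hs ∷ uhs) (ap ∷ aps) =
    AllPairs.++⁺ (chain-unique h) (chains-unique hs uhs aps)
      (All.tabulate λ x∈ → All.tabulate λ y∈ →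
        let h′ , h′∈ , y∈′ = ∈-chains⁻ hs y∈
        in  chains-disjoint ap (All.lookup aps h′∈) (All.lookup h∉hs h′∈) x∈ y∈′)

  length-chains : ∀ hs → length (concatMap chain hs) ≡ sum (map depth hs)
  length-chains []       = refl
  length-chains (h ∷ hs) = trans (length-++ (chain h))
    (cong₂ _+_ (trans (length-map _ (upTo (depth h))) (length-upTo (depth h))) (length-chains hs))

  -- Main counting lemma: for distinct Apéry elements h₁, …, hₙ the chains are
  -- disjoint subsets of L(S), so their depths add up to at most |L(S)|.
  apéry-depths≤ : ∀ hs (Ls : List ℕ) → AllPairs _≢_ hs → All (InAp S μ) hs
                → (∀ {x} → InL S c x → x ∈ Ls) → sum (map depth hs) ≤ length Ls
  apéry-depths≤ hs Ls uhs aps ⊆Ls = subst (_≤ length Ls) (length-chains hs)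
    (length-sublist (concatMap chain hs) Ls (chains-unique hs uhs aps) chains⊆Ls)
    where
    chains⊆Ls : ∀ {x} → x ∈ concatMap chain hs → x ∈ Ls
    chains⊆Ls x∈ with h , h∈ , x∈′ ← ∈-chains⁻ hs x∈ =
      ⊆Ls (chain⊆L (proj₁ (All.lookup aps h∈)) x∈′)

module NaturalBound (S : NumericalSemigroup) (c μ : ℕ) {{_ : NonZero μ}}
                    (conductor : IsConductor S c) (multiplicity : IsMultiplicity S μ)
                    {q₁ q₂ ℓ : ℕ}
                    (P₁ : HasSize (InP₁ S c μ) q₁) (P₂ : HasSize (InP₂ S c μ) q₂)
                    (Lₛ : HasSize (InL S c) ℓ)
                    (ps : List (ℕ × ℕ)) (indep : IsIndependent S c μ ps) where

  open import Data.Nat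
  open import Data.Nat.Properties
  open import Data.Nat.ListAction using (sum)
  open import Data.Nat.ListAction.Properties using (sum-++)
  open import Data.Nat.Tactic.RingSolver using (solve-∀)
  open import Data.List using (_∷_; _++_; map; length)
  open import Data.List.Properties using (length-map; map-++)
  open import Data.List.Membership.Propositional using (_∈_)
  open import Data.List.Membership.Propositional.Properties using (∈-map⁻; ∈-++⁻)
  open import Data.List.Relation.Unary.All as All using (All; _∷_)
  open import Data.List.Relation.Unary.AllPairs as AllPairs using (AllPairs; _∷_)
  import Data.List.Relation.Unary.AllPairs.Properties as AllPairsₚ
  open import Data.Product using (_,_; proj₁; proj₂)
  open import Data.Sum using ([_,_]′)
  open import Function.Bundles using (Equivalence)
  open import Relation.Binary.PropositionalEquality
  open import Algebra.Properties.CommutativeSemigroup +-commutativeSemigroup using (interchange)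
  open Depth c μ
  open AperyChains S μ (proj₁ (proj₁ multiplicity)) c
  open Counting

  A B L : List ℕ
  A = proj₁ P₁
  B = proj₁ P₂
  L = proj₁ Lₛ

  σ : ℕ
  σ = length ps

  |A|≡q₁ : length A ≡ q₁
  |A|≡q₁ = proj₂ (proj₂ (proj₂ P₁))
  |B|≡q₂ : length B ≡ q₂
  |B|≡q₂ = proj₂ (proj₂ (proj₂ P₂))
  |L|≡ℓ : length L ≡ ℓ
  |L|≡ℓ = proj₂ (proj₂ (proj₂ Lₛ))
  A-unique : AllPairs _≢_ A
  A-unique = proj₁ (proj₂ P₁)
  B-unique : AllPairs _≢_ B
  B-unique = proj₁ (proj₂ P₂)

  ∈A⁻ : ∀ {a} → a ∈ A → InP₁ S c μ a
  ∈A⁻ = Equivalence.to (proj₁ (proj₂ (proj₂ P₁)) _)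
  ∈A⁺ : ∀ {a} → InP₁ S c μ a → a ∈ A
  ∈A⁺ = Equivalence.from (proj₁ (proj₂ (proj₂ P₁)) _)
  ∈B⁻ : ∀ {b} → b ∈ B → InP₂ S c μ b
  ∈B⁻ = Equivalence.to (proj₁ (proj₂ (proj₂ P₂)) _)
  ∈B⁺ : ∀ {b} → InP₂ S c μ b → b ∈ B
  ∈B⁺ = Equivalence.from (proj₁ (proj₂ (proj₂ P₂)) _)
  ∈L⁺ : ∀ {x} → InL S c x → x ∈ L
  ∈L⁺ = Equivalence.from (proj₁ (proj₂ (proj₂ Lₛ)) _)

  starts : List ℕ
  starts = 0 ∷ A ++ B

  ∈A++B⁻ : ∀ {x} → x ∈ A ++ B → IsMinGen S x × x ≢ μ
  ∈A++B⁻ x∈ = [ (λ a∈ → let g , a≢μ , _ = ∈A⁻ a∈ in g , a≢μ)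
              , (λ b∈ → let g , b≢μ , _ = ∈B⁻ b∈ in g , b≢μ) ]′ (∈-++⁻ A x∈)

  starts-apéry : All (InAp S μ) starts
  starts-apéry = 0-apéry ∷ All.tabulate λ x∈ →
    let g , x≢μ = ∈A++B⁻ x∈ in minGen-apéry g x≢μ

  2a<c+μ : ∀ {a} → a ∈ A → 2 * a < c + μ
  2a<c+μ a∈ = proj₂ (proj₂ (proj₂ (∈A⁻ a∈)))
  c+μ≤2b : ∀ {b} → b ∈ B → c + μ ≤ 2 * b
  c+μ≤2b b∈ = proj₁ (proj₂ (proj₂ (∈B⁻ b∈)))
  3b<2[c+μ] : ∀ {b} → b ∈ B → 3 * b < 2 * (c + μ)
  3b<2[c+μ] b∈ = proj₂ (proj₂ (proj₂ (∈B⁻ b∈)))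

  A-B-disjoint : ∀ {a b} → a ∈ A → b ∈ B → a ≢ b
  A-B-disjoint a∈ b∈ refl = <-irrefl refl (<-≤-trans (2a<c+μ a∈) (c+μ≤2b b∈))

  starts-unique : AllPairs _≢_ starts
  starts-unique = All.tabulate (λ x∈ 0≡x → x≢0 (∈A++B⁻ x∈) (sym 0≡x))
                ∷ AllPairsₚ.++⁺ A-unique B-unique
                                (All.tabulate λ a∈ → All.tabulate λ b∈ → A-B-disjoint a∈ b∈)
    where
    x≢0 : ∀ {x} → IsMinGen S x × x ≢ μ → x ≢ 0
    x≢0 ((_ , x≢0 , _) , _) = x≢0

  starts-depths≤ℓ : depth 0 + sum (map depth (A ++ B)) ≤ ℓ
  starts-depths≤ℓ = subst (sum (map depth starts) ≤_) |L|≡ℓ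
    (apéry-depths≤ starts L starts-unique starts-apéry ∈L⁺)

  -- The coordinates of the independent pairs: by independence, σ distinct
  -- elements of P₁ and σ distinct elements of P₂.
  firsts seconds : List ℕ
  firsts  = map proj₁ ps
  seconds = map proj₂ ps

  pair⁻ : ∀ {p} → p ∈ ps → IsAperyPair S c μ p
  pair⁻ = proj₁ indep _

  firsts-unique : AllPairs _≢_ firsts
  firsts-unique = AllPairsₚ.map⁺ (AllPairs.map proj₁ (proj₂ indep))

  seconds-unique : AllPairs _≢_ seconds
  seconds-unique = AllPairsₚ.map⁺ (AllPairs.map proj₂ (proj₂ indep))

  firsts⊆A : ∀ {a} → a ∈ firsts → a ∈ A
  firsts⊆A a∈ with p , p∈ , refl ← ∈-map⁻ proj₁ a∈ = ∈A⁺ (proj₁ (pair⁻ p∈))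

  seconds⊆B : ∀ {b} → b ∈ seconds → b ∈ B
  seconds⊆B b∈ with p , p∈ , refl ← ∈-map⁻ proj₂ b∈ = ∈B⁺ (proj₁ (proj₂ (pair⁻ p∈)))

  σ≤q₁ : σ ≤ q₁
  σ≤q₁ = subst₂ _≤_ (length-map proj₁ ps) |A|≡q₁
                    (length-sublist firsts A firsts-unique firsts⊆A)

  σ≤q₂ : σ ≤ q₂
  σ≤q₂ = subst₂ _≤_ (length-map proj₂ ps) |B|≡q₂
                    (length-sublist seconds B seconds-unique seconds⊆B)

  A-depths : sum (map depth firsts) + (q₁ ∸ σ) * quotient 1 ≤ sum (map depth A)
  A-depths = subst₂ (λ n m → sum (map depth firsts) + (n ∸ m) * quotient 1 ≤ sum (map depth A))
    |A|≡q₁ (length-map proj₁ ps)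
    (sum-sublist depth (quotient 1) firsts A firsts-unique firsts⊆A λ a a∈ →
      quotient≤depth 1 a (subst (2 * a <_) (sym (*-identityˡ (c + μ))) (2a<c+μ a∈)))

  B-depths : sum (map depth seconds) + (q₂ ∸ σ) * quotient 2 ≤ sum (map depth B)
  B-depths = subst₂ (λ n m → sum (map depth seconds) + (n ∸ m) * quotient 2 ≤ sum (map depth B))
    |B|≡q₂ (length-map proj₂ ps)
    (sum-sublist depth (quotient 2) seconds B seconds-unique seconds⊆B λ b b∈ →
      quotient≤depth 2 b (3b<2[c+μ] b∈))

  -- An Apéry pair (a, b) has a + b < c + μ, so depth a + depth b ≥ ⌊c/μ⌋.
  pair-depths : σ * (c / μ) ≤ sum (map depth firsts) + sum (map depth seconds)
  pair-depths = sum-pairs depth (c / μ) ps λ p p∈ →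
    ⌊c/μ⌋≤depth-pair _ _ (apéry-< (proj₁ conductor) (proj₂ (proj₂ (pair⁻ p∈))))

  natural-bound : c / μ * (1 + σ) + quotient 1 * (q₁ ∸ σ) + quotient 2 * (q₂ ∸ σ) ≤ ℓ
  natural-bound = begin
      c / μ * (1 + σ) + quotient 1 * (q₁ ∸ σ) + quotient 2 * (q₂ ∸ σ)
        ≡⟨ rearrange (c / μ) σ (quotient 1) (quotient 2) (q₁ ∸ σ) (q₂ ∸ σ) ⟩
      c / μ + (σ * (c / μ) + ((q₁ ∸ σ) * quotient 1 + (q₂ ∸ σ) * quotient 2))
        ≤⟨ +-mono-≤ ⌊c/μ⌋≤depth0 (+-monoˡ-≤ _ pair-depths) ⟩
      depth 0 + ((Σfirsts + Σseconds) + ((q₁ ∸ σ) * quotient 1 + (q₂ ∸ σ) * quotient 2))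
        ≡⟨ cong (depth 0 +_) (interchange Σfirsts Σseconds _ _) ⟩
      depth 0 + ((Σfirsts + (q₁ ∸ σ) * quotient 1) + (Σseconds + (q₂ ∸ σ) * quotient 2))
        ≤⟨ +-monoʳ-≤ (depth 0) (+-mono-≤ A-depths B-depths) ⟩
      depth 0 + (sum (map depth A) + sum (map depth B))
        ≡⟨ cong (depth 0 +_) (trans (cong sum (map-++ depth A B)) (sum-++ (map depth A) _)) ⟨
      depth 0 + sum (map depth (A ++ B))
        ≤⟨ starts-depths≤ℓ ⟩
      ℓ ∎
    where
    open ≤-Reasoning
    Σfirsts Σseconds : ℕ
    Σfirsts  = sum (map depth firsts)
    Σseconds = sum (map depth seconds)
    rearrange : ∀ K σ t₁ t₂ r₁ r₂
              → K * (1 + σ) + t₁ * r₁ + t₂ * r₂ ≡ K + (σ * K + (r₁ * t₁ + r₂ * t₂))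
    rearrange = solve-∀

module Floors where

  open import Data.Nat as ℕ using (suc)
  open import Data.Integer as ℤ using (+<+)
  import Data.Integer.Properties as ℤP
  open import Data.Integer.DivMod using ([n/d]*d≤n)
  open import Data.Rational as ℚ using (ℚ; mkℚ; floor; ½; Positive)
  open import Data.Rational.Literals using (fromℤ)
  import Data.Rational.Properties as ℚP
  import Data.Rational.Unnormalised as ℚᵘ
  import Data.Rational.Unnormalised.Properties as ℚᵘP
  open import Data.Rational.Solver using (module +-*-Solver)
  open import Relation.Binary.PropositionalEquality

  ι : ℕ → ℚ
  ι n = fromℤ (ℤ.+ n)

  ι-+ : ∀ m n → ι (m ℕ.+ n) ≡ ι m ℚ.+ ι n
  ι-+ m n = ℚP.toℚᵘ-injective
    (ℚᵘP.≃-sym (ℚᵘP.≃-trans (ℚP.toℚᵘ-homo-+ (ι m) (ι n)) (ℚᵘ.*≡* eq)))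
    where
    eq : (ℤ.+ m ℤ.* ℤ.+ 1 ℤ.+ ℤ.+ n ℤ.* ℤ.+ 1) ℤ.* ℤ.+ 1 ≡ ℤ.+ (m ℕ.+ n) ℤ.* ℤ.+ 1
    eq = cong (ℤ._* ℤ.+ 1)
      (trans (cong₂ ℤ._+_ (ℤP.*-identityʳ (ℤ.+ m)) (ℤP.*-identityʳ (ℤ.+ n))) (sym (ℤP.pos-+ m n)))

  ι-* : ∀ m n → ι (m ℕ.* n) ≡ ι m ℚ.* ι n
  ι-* m n = ℚP.toℚᵘ-injective (ℚᵘP.≃-sym (ℚᵘP.≃-trans (ℚP.toℚᵘ-homo-* (ι m) (ι n))
    (ℚᵘ.*≡* (cong (ℤ._* ℤ.+ 1) (sym (ℤP.pos-* m n))))))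

  -- p < n implies ⌊p⌋ < n, by ⌊p⌋ · den p ≤ num p.
  floor-< : ∀ p n → p ℚ.< ι n → floor p ℤ.< ℤ.+ n
  floor-< (mkℚ num d _) n (ℚ.*<* p<n) = ℤP.*-cancelʳ-<-nonNeg (ℤ.+ suc d)
    (ℤP.≤-<-trans ([n/d]*d≤n num (ℤ.+ suc d))
                  (subst (ℤ._< ℤ.+ n ℤ.* ℤ.+ suc d) (ℤP.*-identityʳ num) p<n))

  c/μ<ι : ∀ c μ .{{_ : NonZero μ}} n → c ℕ.< n ℕ.* μ → ℤ.+ c ℚ./ μ ℚ.< ι n
  c/μ<ι c μ@(suc m) n c<nμ = ℚP.toℚᵘ-cancel-<
    (ℚᵘP.<-respˡ-≃ (ℚᵘP.≃-sym (ℚP.toℚᵘ-fromℚᵘ (ℚᵘ.mkℚᵘ (ℤ.+ c) m)))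
    (ℚᵘ.*<* (subst₂ ℤ._<_ (sym (ℤP.*-identityʳ (ℤ.+ c))) (ℤP.pos-* n μ) (+<+ c<nμ))))

  floor-affine< : ∀ c μ .{{_ : NonZero μ}} (α β : ℚ) .{{_ : Positive α}} (n t : ℕ)
    → c ℕ.< n ℕ.* μ → α ℚ.* ι n ℚ.- β ≡ ι t
    → floor (α ℚ.* (ℤ.+ c ℚ./ μ) ℚ.- β) ℤ.< ℤ.+ t
  floor-affine< c μ α β n t c<nμ αn-β≡t = floor-< _ t
    (ℚP.<-respʳ-≡ αn-β≡t (ℚP.+-monoˡ-< (ℚ.- β) (ℚP.*-monoʳ-<-pos α (c/μ<ι c μ n c<nμ))))

  open +-*-Solver

  ⌊c/μ⌋< : ∀ c μ .{{_ : NonZero μ}} K → c ℕ.< suc K ℕ.* μ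
         → floor (ℤ.+ c ℚ./ μ) ℤ.< ℤ.+ suc K
  ⌊c/μ⌋< c μ K c<[1+K]μ = floor-< _ (suc K) (c/μ<ι c μ (suc K) c<[1+K]μ)

  ⌊c/2μ-½⌋< : ∀ c μ .{{_ : NonZero μ}} t → c ℕ.< (2 ℕ.* t ℕ.+ 1) ℕ.* μ
            → floor (½ ℚ.* (ℤ.+ c ℚ./ μ) ℚ.- ½) ℤ.< ℤ.+ t
  ⌊c/2μ-½⌋< c μ t c< = floor-affine< c μ ½ ½ (2 ℕ.* t ℕ.+ 1) t c< (begin
      ½ ℚ.* ι (2 ℕ.* t ℕ.+ 1) ℚ.- ½
        ≡⟨ cong (λ x → ½ ℚ.* x ℚ.- ½) (trans (ι-+ (2 ℕ.* t) 1) (cong (ℚ._+ ι 1) (ι-* 2 t))) ⟩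
      ½ ℚ.* (ι 2 ℚ.* ι t ℚ.+ ι 1) ℚ.- ½
        ≡⟨ solve 1 (λ z → con ½ :* (con (ι 2) :* z :+ con (ι 1)) :- con ½ := z) refl (ι t) ⟩
      ι t ∎)
    where open ≡-Reasoning

  ⌊c/3μ-⅔⌋< : ∀ c μ .{{_ : NonZero μ}} t → c ℕ.< (3 ℕ.* t ℕ.+ 2) ℕ.* μ
            → floor ((ℤ.+ 1 ℚ./ 3) ℚ.* (ℤ.+ c ℚ./ μ) ℚ.- (ℤ.+ 2 ℚ./ 3)) ℤ.< ℤ.+ t
  ⌊c/3μ-⅔⌋< c μ t c< = floor-affine< c μ ⅓ ⅔ (3 ℕ.* t ℕ.+ 2) t c< (begin
      ⅓ ℚ.* ι (3 ℕ.* t ℕ.+ 2) ℚ.- ⅔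
        ≡⟨ cong (λ x → ⅓ ℚ.* x ℚ.- ⅔) (trans (ι-+ (3 ℕ.* t) 2) (cong (ℚ._+ ι 2) (ι-* 3 t))) ⟩
      ⅓ ℚ.* (ι 3 ℚ.* ι t ℚ.+ ι 2) ℚ.- ⅔
        ≡⟨ solve 1 (λ z → con ⅓ :* (con (ι 3) :* z :+ con (ι 2)) :- con ⅔ := z) refl (ι t) ⟩
      ι t ∎)
    where
    open ≡-Reasoning
    ⅓ ⅔ : ℚ
    ⅓ = ℤ.+ 1 ℚ./ 3
    ⅔ = ℤ.+ 2 ℚ./ 3

-- The integer combination of the statement is monotone in its three floor
-- coefficients, so it suffices to bound it with natural coefficients.
module IntegerBound where

  open import Data.Nat as ℕ using (suc; _∸_)
  open import Data.Integer as ℤ using (ℤ; +_; _≤_; _<_; _+_; _*_; _-_; +≤+)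
  import Data.Integer.Properties as ℤP
  open import Relation.Binary.PropositionalEquality

  <1+⇒≤ : ∀ {i K} → i < + suc K → i ≤ + K
  <1+⇒≤ = ℤP.i<j⇒i≤pred[j]

  <⇒+1≤ : ∀ {i t} → i < + t → i + + 1 ≤ + t
  <⇒+1≤ {i} i<t = subst (_≤ _) (ℤP.+-comm (+ 1) i) (ℤP.i<j⇒suc[i]≤j i<t)

  -[≤] : ∀ {q σ} → σ ℕ.≤ q → + q - + σ ≡ + (q ∸ σ)
  -[≤] {q} {σ} σ≤q = trans (ℤP.m-n≡m⊖n q σ) (ℤP.⊖-≥ σ≤q)

  combine : ∀ {F₀ F₁ F₂ : ℤ} {K t₁ t₂ σ q₁ q₂ ℓ : ℕ}
    → F₀ ≤ + K → F₁ + + 1 ≤ + t₁ → F₂ + + 1 ≤ + t₂ → σ ℕ.≤ q₁ → σ ℕ.≤ q₂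
    → K ℕ.* (1 ℕ.+ σ) ℕ.+ t₁ ℕ.* (q₁ ∸ σ) ℕ.+ t₂ ℕ.* (q₂ ∸ σ) ℕ.≤ ℓ
    → F₀ * (+ 1 + + σ) + (F₁ + + 1) * (+ q₁ - + σ) + (F₂ + + 1) * (+ q₂ - + σ) ≤ + ℓ
  combine {F₀} {F₁} {F₂} {K} {t₁} {t₂} {σ} {q₁} {q₂} {ℓ}
          F₀≤K F₁+1≤t₁ F₂+1≤t₂ σ≤q₁ σ≤q₂ nat-bound
    rewrite -[≤] σ≤q₁ | -[≤] σ≤q₂ = begin
      F₀ * + (1 ℕ.+ σ) + (F₁ + + 1) * + (q₁ ∸ σ) + (F₂ + + 1) * + (q₂ ∸ σ)
        ≤⟨ ℤP.+-mono-≤ (ℤP.+-mono-≤ (ℤP.*-monoʳ-≤-nonNeg _ F₀≤K)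
                                    (ℤP.*-monoʳ-≤-nonNeg _ F₁+1≤t₁))
                       (ℤP.*-monoʳ-≤-nonNeg _ F₂+1≤t₂) ⟩
      + K * + (1 ℕ.+ σ) + + t₁ * + (q₁ ∸ σ) + + t₂ * + (q₂ ∸ σ)
        ≡⟨ cong₂ _+_ (cong₂ _+_ (ℤP.pos-* K _) (ℤP.pos-* t₁ _)) (ℤP.pos-* t₂ _) ⟨
      + (K ℕ.* (1 ℕ.+ σ) ℕ.+ t₁ ℕ.* (q₁ ∸ σ) ℕ.+ t₂ ℕ.* (q₂ ∸ σ))
        ≤⟨ +≤+ nat-bound ⟩
      + ℓ ∎
    where open ℤP.≤-Reasoning

open import Data.Nat using (ℕ; _+_; _*_; _<_)
open import Data.Integer using (+_; _≤_)
open import Relation.Binary.PropositionalEquality using (_≢_)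
open import Data.Nat using (zero; suc; _/_)
open import Data.Integer using (ℤ)
open import Data.Rational as ℚ using (floor; ½)
open import Data.Product using (_,_)
open import Relation.Binary.PropositionalEquality using (refl)
open import Relation.Nullary using (contradiction)
open Division using (m<[1+m/d]*d)
open Floors
open IntegerBound

-- μ ≠ 0 since μ is a generator; the bound is then natural-bound with its three
-- coefficients ⌊c/μ⌋, ⌊(c+μ)/2μ⌋, ⌊(c+μ)/3μ⌋ compared to the floors of the statement.
proposition3p3 : (S : NumericalSemigroup) (c μ : ℕ)
    → IsConductor S c
    → IsMultiplicity S μ
    → (∀ a → IsMinGen S a → a ≢ μ → c + μ < 3 * a)
    → (q₁ q₂ σ ℓ : ℕ)
    → HasSize (InP₁ S c μ) q₁
    → HasSize (InP₂ S c μ) q₂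
    → IsMaxIndep S c μ σ
    → HasSize (InL S c) ℓ
    → bound c μ σ q₁ q₂ ≤ + ℓ
proposition3p3 S c zero _ ((_ , μ≢0 , _) , _) _ _ _ _ _ _ _ _ _ = contradiction refl μ≢0
proposition3p3 S c μ@(suc _) conductor multiplicity _ q₁ q₂ _ ℓ P₁ P₂
               ((ps , indep , refl) , _) Lₛ =
  combine {F₁ = ⌊c/2μ-½⌋} {F₂ = ⌊c/3μ-⅔⌋}
          (<1+⇒≤ (⌊c/μ⌋< c μ (c / μ) (m<[1+m/d]*d c μ)))
          (<⇒+1≤ (⌊c/2μ-½⌋< c μ (quotient 1) (c<quotient 1)))
          (<⇒+1≤ (⌊c/3μ-⅔⌋< c μ (quotient 2) (c<quotient 2)))
          σ≤q₁ σ≤q₂ natural-bound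
  where
  open NaturalBound S c μ conductor multiplicity P₁ P₂ Lₛ ps indep
  open Depth c μ using (quotient; c<quotient)
  ⌊c/2μ-½⌋ ⌊c/3μ-⅔⌋ : ℤ
  ⌊c/2μ-½⌋ = floor (½ ℚ.* (+ c ℚ./ μ) ℚ.- ½)
  ⌊c/3μ-⅔⌋ = floor ((+ 1 ℚ./ 3) ℚ.* (+ c ℚ./ μ) ℚ.- (+ 2 ℚ./ 3))
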